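{- Let $M$ be a matroid on $A$ and $N$ a matroid on $B$, each with at least two elements. Let $T=A\cap B$ and $K=M|T$, and assume $N|T=K$, that $\mathrm{cl}_M(T)$ is a modular flat of $M$, and that each element of $\mathrm{cl}_M(T)-T$ is either a loop or parallel to an element of $T$. If $M$ and $N$ are both irreducible, then the generalized parallel connection $P_K(M,N)$ is irreducible.
   Context: Under the stated hypotheses, the generalized parallel connection $P_K(M,N)$ is the matroid on $A\cup B$ whose flats are exactly the sets $F\subseteq A\cup B$ such that $F\cap A$ is a flat of $M$ and $F\cap B$ is a flat of $N$. A flat $F$ is modular if $r(F)+r(G)=r(F\cup G)+r(F\cap G)$ for every flat $G$. Irreducibility: for a matroid $L$ on $E$ and $C,D\subseteq E$ with $C\cup D=E$, $(C,D)$ is a free separator of $L$ if $L=L|C\mathbin{\Join} L.D$, where $L.D=L/(E-D)$ and, for matroids $M'(A')$, $N'(B')$ with $M'/(A'-B')=N'|(A'\cap B')$, the free splice $M'\mathbin{\Join} N'$ is the matroid on $A'\cup B'$ with rank $r(X)=\min\{r_{M'}(X\cap A')+|X-A'|,\ r_{N'}(X\cap B')+r_{M'}(A'-B')\}$; $L$ is irreducible if it has no free separator $(C,D)$ with $C-D$ and $D-C$ both nonempty. -}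

module Defs where

open import Data.Nat using (ℕ; _+_; _∸_; _≤_; _<_; _⊔_; _⊓_)
import Data.Nat as ℕ
open import Data.Fin using (Fin)
open import Data.Fin.Subset
open import Data.Fin.Subset.Properties using (_∈?_)
open import Data.Bool using (_∧_)
open import Data.Vec using (tabulate)
open import Data.Product using (_×_; Σ; ∃; _,_)
open import Relation.Nullary using (¬_; ⌊_⌋)
open import Relation.Binary.PropositionalEquality using (_≡_; _≢_)
open import Level using (0ℓ)

-- Ground sets are subsets of a common finite universe Fin n.
-- A matroid on the ground set E is given by its rank function
-- (only its values on subsets of E are meaningful), satisfying
-- the rank axioms (R1)-(R3) on subsets of E.
record Matroid (n : ℕ) : Set where
  field
    E    : Subset n
    r    : Subset n → ℕ
    r-bound   : ∀ X → X ⊆ E → r X ≤ ∣ X ∣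
    r-mono    : ∀ X Y → Y ⊆ E → X ⊆ Y → r X ≤ r Y
    r-submod  : ∀ X Y → X ⊆ E → Y ⊆ E → r (X ∪ Y) + r (X ∩ Y) ≤ r X + r Y
open Matroid public

IsFlat : ∀ {n} → Matroid n → Subset n → Set
IsFlat M F = F ⊆ E M × (∀ x → x ∈ E M → x ∉ F → r M F < r M (F ∪ ⁅ x ⁆))

cl : ∀ {n} → Matroid n → Subset n → Subset n
cl M X = tabulate λ x → ⌊ x ∈? E M ⌋ ∧ ⌊ r M (X ∪ ⁅ x ⁆) ℕ.≟ r M X ⌋

IsModularFlat : ∀ {n} → Matroid n → Subset n → Set
IsModularFlat M F =
  IsFlat M F × (∀ G → IsFlat M G → r M F + r M G ≡ r M (F ∪ G) + r M (F ∩ G))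

IsLoop : ∀ {n} → Matroid n → Fin n → Set
IsLoop M x = x ∈ E M × r M ⁅ x ⁆ ≡ 0

IsParallel : ∀ {n} → Matroid n → Fin n → Fin n → Set
IsParallel M x y =
  x ∈ E M × y ∈ E M × x ≢ y × r M ⁅ x ⁆ ≡ 1 × r M ⁅ y ⁆ ≡ 1 × r M (⁅ x ⁆ ∪ ⁅ y ⁆) ≡ 1

restrictRank : ∀ {n} → Matroid n → Subset n → (Subset n → ℕ)
restrictRank L C X = r L X

contractRank : ∀ {n} → Matroid n → Subset n → (Subset n → ℕ)
contractRank L Z Y = r L (Y ∪ Z) ∸ r L Z

spliceRank : ∀ {n} → (Subset n → ℕ) → Subset n → (Subset n → ℕ) → Subset n →
             Subset n → ℕ
spliceRank rM A' rN B' X = (rM (X ∩ A') + ∣ X ─ A' ∣) ⊓ (rN (X ∩ B') + rM (A' ─ B'))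

-- (C, D) is a free separator of L: C ∪ D = E and L = L|C ⋈ L.D,
-- where L.D = L/(E - D).  (The compatibility condition
-- (L|C)/(C-D) = (L.D)|(C∩D) holds automatically.)
IsFreeSeparator : ∀ {n} → Matroid n → Subset n → Subset n → Set
IsFreeSeparator L C D =
  C ∪ D ≡ E L ×
  (∀ X → X ⊆ E L →
     r L X ≡ spliceRank (restrictRank L C) C (contractRank L (E L ─ D)) D X)

Irreducible : ∀ {n} → Matroid n → Set
Irreducible L = ∀ C D → IsFreeSeparator L C D →
  ¬ (Nonempty (C ─ D) × Nonempty (D ─ C))

IsGenParallelConnection : ∀ {n} → Matroid n → Matroid n → Matroid n → Set
IsGenParallelConnection M N P =
  E P ≡ E M ∪ E N ×
  (∀ F → F ⊆ E M ∪ E N →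
     (IsFlat P F → IsFlat M (F ∩ E M) × IsFlat N (F ∩ E N)) ×
     (IsFlat M (F ∩ E M) × IsFlat N (F ∩ E N) → IsFlat P F))

module Submission where

-- Write d ⇒ c (SpanForces L d c) when every set W ∌ d that spans d spans c once d is added.
-- A free separator (C, D) gives d ⇒ c for all c ∈ C − D and d ∈ D − C; conversely d ⇒ c with
-- c ≠ d gives the free separator (E − d, E − c).  So an irreducible matroid has no such pair,
-- hence (when |E| ≥ 2) no loops, no coloops and no parallel pairs.  Flats of P restrict to flats
-- of M and of N, so for X ⊆ A the closure cl_P(X) lies in cl_M(X) ∪ cl_N(cl_M(X) ∩ B) and meets
-- A in cl_M(X); a pair d ⇒ c of P inside A (or inside B) is therefore a pair of M (or of N).
-- The hypothesis on cl_M(T) − T and irreducibility of M give cl_M(T) = T.  If c ∈ A − B and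
-- d ∈ B − A, then B − d spans d in N, which puts c into cl_M(T) = T ⊆ B.  If c ∈ B − A and
-- d ∈ A − B, shrink A − d to a set Y independent over T: modularity of T makes T ∩ cl_M(Y ∪ d)
-- have rank at most 1 while Y ∪ (T ∩ cl_M(Y ∪ d)) still spans d, so c is a loop of N or
-- parallel in N to an element of T.

open import Defs
open import Data.Bool.Properties using (T-≡; T-∧)
open import Data.Empty using (⊥-elim)
open import Data.Fin using (Fin)
open import Data.Fin.Properties using (any?) renaming (_≟_ to _≟ᶠ_)
open import Data.Fin.Subset
  using (Subset; inside; outside; ⊥; ⁅_⁆; _∩_; _∪_; _─_; _-_; _∈_; _∉_; _⊆_; _⊂_; ∣_∣)
open import Data.Fin.Subset.Induction using (⊂-wellFounded)
open import Data.Fin.Subset.Properties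
open import Data.Nat using (ℕ; suc; s≤s; _≤_; _<_; _+_; _∸_; _⊓_)
open import Data.Nat.Properties
open import Data.Product using (_×_; ∃; _,_; proj₁; proj₂; swap)
open import Data.Sum using (_⊎_; inj₁; inj₂; [_,_]′)
open import Data.Vec using (_∷_; here; there)
open import Data.Vec.Properties using ([]=⇒lookup; lookup⇒[]=; lookup∘tabulate)
open import Function.Bundles using (Equivalence)
open import Induction.WellFounded using (module All)
open import Relation.Binary.PropositionalEquality using (_≡_; _≢_; refl; sym; trans; cong; subst)
open import Relation.Nullary using (¬_; yes; no; _×-dec_; ¬?; ⌊_⌋)
open import Relation.Nullary.Decidable using (toWitness; fromWitness)

open Equivalence using (to; from)

private variable
  n : ℕ
  x y : Fin n
  p q s : Subset n

x∈p─q⁻ : ∀ (p q : Subset n) → x ∈ p ─ q → x ∈ p × x ∉ q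
x∈p─q⁻ p q x∈ = p─q⊆p p q x∈ , ∉q p q x∈
  where
  ∉q : ∀ {n} {x : Fin n} (p q : Subset n) → x ∈ p ─ q → x ∉ q
  ∉q (inside ∷ p) (outside ∷ q) here       ()
  ∉q (_      ∷ p) (_       ∷ q) (there x∈) (there x∈q) = ∉q p q x∈ x∈q

∪-least : p ⊆ s → q ⊆ s → p ∪ q ⊆ s
∪-least {p = p} {q = q} p⊆s q⊆s x∈ = [ p⊆s , q⊆s ]′ (x∈p∪q⁻ p q x∈)

x∈p⇒⁅x⁆⊆p : x ∈ p → ⁅ x ⁆ ⊆ p
x∈p⇒⁅x⁆⊆p {x = x} x∈p y∈ with x∈⁅y⁆⇒x≡y x y∈
... | refl = x∈p

∪⁅⁆-least : p ⊆ q → x ∈ q → p ∪ ⁅ x ⁆ ⊆ q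
∪⁅⁆-least p⊆q x∈q = ∪-least p⊆q (x∈p⇒⁅x⁆⊆p x∈q)

x∈p∪q∧x∉p⇒x∈q : x ∈ p ∪ q → x ∉ p → x ∈ q
x∈p∪q∧x∉p⇒x∈q {p = p} {q = q} x∈ x∉p =
  [ (λ x∈p → ⊥-elim (x∉p x∈p)) , (λ x∈q → x∈q) ]′ (x∈p∪q⁻ p q x∈)

x∈p∪q∧x∉q⇒x∈p : x ∈ p ∪ q → x ∉ q → x ∈ p
x∈p∪q∧x∉q⇒x∈p {p = p} {q = q} x∈ x∉q =
  [ (λ x∈p → x∈p) , (λ x∈q → ⊥-elim (x∉q x∈q)) ]′ (x∈p∪q⁻ p q x∈)

x∉p-x : x ∉ p - x
x∉p-x {x = x} {p = p} x∈ = proj₂ (x∈p─q⁻ p ⁅ x ⁆ x∈) (x∈⁅x⁆ x)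

p⊆q⇒p─[q-y]⊆⁅y⁆ : p ⊆ q → p ─ (q - y) ⊆ ⁅ y ⁆
p⊆q⇒p─[q-y]⊆⁅y⁆ {p = p} {q = q} {y = y} p⊆q {x} x∈ with x ≟ᶠ y | x∈p─q⁻ p (q - y) x∈
... | yes refl | _          = x∈⁅x⁆ y
... | no x≢y   | x∈p , x∉q-y = ⊥-elim (x∉q-y (x∈p∧x≢y⇒x∈p-y (p⊆q x∈p) x≢y))

2≤∣p∣⇒∃≢ : 2 ≤ ∣ p ∣ → x ∈ p → ∃ λ y → y ∈ p × y ≢ x
2≤∣p∣⇒∃≢ {p = p} {x = x} 2≤ x∈p with any? (λ y → (y ∈? p) ×-dec ¬? (y ≟ᶠ x))
... | yes other = other
... | no none =
  ⊥-elim (<⇒≱ 2≤ (≤-trans (p⊆q⇒∣p∣≤∣q∣ p⊆⁅x⁆) (≤-reflexive (∣⁅x⁆∣≡1 x))))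
  where
  p⊆⁅x⁆ : p ⊆ ⁅ x ⁆
  p⊆⁅x⁆ {y} y∈p with y ≟ᶠ x
  ... | yes refl = x∈⁅x⁆ x
  ... | no y≢x   = ⊥-elim (none (y , y∈p , y≢x))

deletion-induction : (P : Subset n → Set) →
  (∀ S → (∀ {s} → s ∈ S → P (S - s)) → P S) → ∀ S → P S
deletion-induction P step =
  All.wfRec ⊂-wellFounded _ P λ S rec → step S λ s∈S → rec (x∈p⇒p-x⊂p s∈S)

≡-⊓ : ∀ {m a b} → m ≤ a → m ≤ b → a ≤ m ⊎ b ≤ m → m ≡ a ⊓ b
≡-⊓ {a = a} {b} m≤a m≤b (inj₁ a≤m) = ≤-antisym (⊓-glb m≤a m≤b) (≤-trans (m⊓n≤m a b) a≤m)
≡-⊓ {a = a} {b} m≤a m≤b (inj₂ b≤m) = ≤-antisym (⊓-glb m≤a m≤b) (≤-trans (m⊓n≤n a b) b≤m)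

module Closure (L : Matroid n) where
  open ≤-Reasoning

  r-monotone : ∀ {X Y} → Y ⊆ E L → X ⊆ Y → r L X ≤ r L Y
  r-monotone = r-mono L _ _

  r-subadditive : ∀ {A B} → A ⊆ E L → B ⊆ E L → r L (A ∪ B) ≤ r L A + r L B
  r-subadditive A⊆E B⊆E = ≤-trans (m≤m+n _ _) (r-submod L _ _ A⊆E B⊆E)

  r-∪⁅⁆≤suc : ∀ {X x} → X ⊆ E L → x ∈ E L → r L (X ∪ ⁅ x ⁆) ≤ suc (r L X)
  r-∪⁅⁆≤suc {X} {x} X⊆E x∈E = begin
    r L (X ∪ ⁅ x ⁆)   ≤⟨ r-subadditive X⊆E (x∈p⇒⁅x⁆⊆p x∈E) ⟩
    r L X + r L ⁅ x ⁆ ≤⟨ +-monoʳ-≤ (r L X) (r-bound L ⁅ x ⁆ (x∈p⇒⁅x⁆⊆p x∈E)) ⟩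
    r L X + ∣ ⁅ x ⁆ ∣ ≡⟨ cong (r L X +_) (∣⁅x⁆∣≡1 x) ⟩
    r L X + 1         ≡⟨ +-comm (r L X) 1 ⟩
    suc (r L X)       ∎

  r≤r-∪⁅⁆ : ∀ {X x} → X ⊆ E L → x ∈ E L → r L X ≤ r L (X ∪ ⁅ x ⁆)
  r≤r-∪⁅⁆ X⊆E x∈E = r-monotone (∪⁅⁆-least X⊆E x∈E) (p⊆p∪q _)

  r-increment-antitone : ∀ {X Z A} → X ⊆ Z → Z ⊆ E L → X ∪ A ⊆ E L →
                         r L (Z ∪ A) + r L X ≤ r L Z + r L (X ∪ A)
  r-increment-antitone {X} {Z} {A} X⊆Z Z⊆E XA⊆E = begin
    r L (Z ∪ A) + r L X                   ≤⟨ +-mono-≤ (r-monotone (∪-least Z⊆E XA⊆E) Z∪A⊆)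
                                                      (r-monotone (λ x∈ → Z⊆E (p∩q⊆p _ _ x∈)) X⊆) ⟩
    r L (Z ∪ (X ∪ A)) + r L (Z ∩ (X ∪ A)) ≤⟨ r-submod L Z (X ∪ A) Z⊆E XA⊆E ⟩
    r L Z + r L (X ∪ A)                   ∎
    where
    Z∪A⊆ : Z ∪ A ⊆ Z ∪ (X ∪ A)
    Z∪A⊆ = ∪-least (p⊆p∪q _) (λ a∈ → q⊆p∪q Z _ (q⊆p∪q X A a∈))
    X⊆ : X ⊆ Z ∩ (X ∪ A)
    X⊆ x∈ = x∈p∩q⁺ (X⊆Z x∈ , p⊆p∪q A x∈)

  x∈cl⁻ : ∀ {X x} → x ∈ cl L X → x ∈ E L × r L (X ∪ ⁅ x ⁆) ≡ r L X
  x∈cl⁻ {X} {x} x∈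
    with T-∧ {⌊ x ∈? E L ⌋} .to (T-≡ .from (trans (sym (lookup∘tabulate _ x)) ([]=⇒lookup x∈)))
  ... | x∈E , r≡ = toWitness x∈E , toWitness r≡

  x∈cl⁺ : ∀ {X x} → x ∈ E L → r L (X ∪ ⁅ x ⁆) ≡ r L X → x ∈ cl L X
  x∈cl⁺ {X} {x} x∈E r≡ = lookup⇒[]= x _ (trans (lookup∘tabulate _ x)
    (T-≡ .to (T-∧ {⌊ x ∈? E L ⌋} .from (fromWitness x∈E , fromWitness r≡))))

  r-∪⁅⁆≤⇒∈cl : ∀ {X x} → X ⊆ E L → x ∈ E L → r L (X ∪ ⁅ x ⁆) ≤ r L X → x ∈ cl L X
  r-∪⁅⁆≤⇒∈cl X⊆E x∈E r≤ = x∈cl⁺ x∈E (≤-antisym r≤ (r≤r-∪⁅⁆ X⊆E x∈E))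

  ∉cl⇒r< : ∀ {X x} → X ⊆ E L → x ∈ E L → x ∉ cl L X → r L X < r L (X ∪ ⁅ x ⁆)
  ∉cl⇒r< X⊆E x∈E x∉cl =
    ≤∧≢⇒< (r≤r-∪⁅⁆ X⊆E x∈E) (λ r≡ → x∉cl (x∈cl⁺ x∈E (sym r≡)))

  cl⊆E : ∀ {X} → cl L X ⊆ E L
  cl⊆E x∈ = proj₁ (x∈cl⁻ x∈)

  X⊆cl : ∀ {X} → X ⊆ E L → X ⊆ cl L X
  X⊆cl X⊆E x∈ =
    r-∪⁅⁆≤⇒∈cl X⊆E (X⊆E x∈) (r-monotone X⊆E (∪⁅⁆-least (λ y∈ → y∈) x∈))

  cl-mono : ∀ {X Z} → X ⊆ Z → Z ⊆ E L → cl L X ⊆ cl L Z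
  cl-mono {X} {Z} X⊆Z Z⊆E {y} y∈ = r-∪⁅⁆≤⇒∈cl Z⊆E y∈E (+-cancelʳ-≤ (r L X) _ _ (begin
    r L (Z ∪ ⁅ y ⁆) + r L X ≤⟨ r-increment-antitone X⊆Z Z⊆E
                                 (∪⁅⁆-least (λ x∈ → Z⊆E (X⊆Z x∈)) y∈E) ⟩
    r L Z + r L (X ∪ ⁅ y ⁆) ≡⟨ cong (r L Z +_) (proj₂ (x∈cl⁻ y∈)) ⟩
    r L Z + r L X           ∎))
    where y∈E = cl⊆E y∈

  cl-least : ∀ {F X} → IsFlat L F → X ⊆ F → cl L X ⊆ F
  cl-least {F} {X} (F⊆E , F-closed) X⊆F {y} y∈ with y ∈? F
  ... | yes y∈F = y∈F
  ... | no y∉F =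
    ⊥-elim (<⇒≢ (F-closed y (cl⊆E y∈) y∉F) (sym (proj₂ (x∈cl⁻ (cl-mono X⊆F F⊆E y∈)))))

  r-∪-cl : ∀ {X} → X ⊆ E L → ∀ S → S ⊆ cl L X → r L (X ∪ S) ≤ r L X
  r-∪-cl {X} X⊆E = deletion-induction (λ S → S ⊆ cl L X → r L (X ∪ S) ≤ r L X) step
    where
    step : ∀ S → (∀ {s} → s ∈ S → S - s ⊆ cl L X → r L (X ∪ (S - s)) ≤ r L X) →
           S ⊆ cl L X → r L (X ∪ S) ≤ r L X
    step S ih S⊆cl with nonempty? S
    ... | no S-empty = r-monotone X⊆E (∪-least (λ x∈ → x∈) (λ s∈ → ⊥-elim (S-empty (_ , s∈))))
    ... | yes (s , s∈S) = begin
      r L (X ∪ S)      ≤⟨ r-monotone (∪⁅⁆-least X'⊆E (cl⊆E (S⊆cl s∈S))) X∪S⊆ ⟩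
      r L (X' ∪ ⁅ s ⁆) ≡⟨ proj₂ (x∈cl⁻ (cl-mono (p⊆p∪q _) X'⊆E (S⊆cl s∈S))) ⟩
      r L X'           ≤⟨ ih s∈S (λ t∈ → S⊆cl (p─q⊆p _ _ t∈)) ⟩
      r L X            ∎
      where
      X' = X ∪ (S - s)
      X'⊆E : X' ⊆ E L
      X'⊆E = ∪-least X⊆E (λ t∈ → cl⊆E (S⊆cl (p─q⊆p _ _ t∈)))
      X∪S⊆ : X ∪ S ⊆ X' ∪ ⁅ s ⁆
      X∪S⊆ {t} t∈ with x∈p∪q⁻ X S t∈ | t ≟ᶠ s
      ... | inj₁ t∈X | _        = p⊆p∪q _ (p⊆p∪q _ t∈X)
      ... | inj₂ _   | yes refl = q⊆p∪q X' _ (x∈⁅x⁆ s)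
      ... | inj₂ t∈S | no t≢s   = p⊆p∪q _ (q⊆p∪q X _ (x∈p∧x≢y⇒x∈p-y t∈S t≢s))

  r-cl : ∀ {X} → X ⊆ E L → r L (cl L X) ≤ r L X
  r-cl {X} X⊆E =
    ≤-trans (r-monotone (∪-least X⊆E cl⊆E) (q⊆p∪q X _)) (r-∪-cl X⊆E _ (λ x∈ → x∈))

  cl-isFlat : ∀ {X} → X ⊆ E L → IsFlat L (cl L X)
  cl-isFlat {X} X⊆E = cl⊆E , λ z z∈E z∉ → begin-strict
    r L (cl L X)         ≤⟨ r-cl X⊆E ⟩
    r L X                <⟨ ∉cl⇒r< X⊆E z∈E z∉ ⟩
    r L (X ∪ ⁅ z ⁆)      ≤⟨ r-monotone (∪⁅⁆-least cl⊆E z∈E)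
                                       (∪-least (λ x∈ → p⊆p∪q _ (X⊆cl X⊆E x∈)) (q⊆p∪q _ _)) ⟩
    r L (cl L X ∪ ⁅ z ⁆) ∎

  cl-idem : ∀ {X Y} → X ⊆ E L → Y ⊆ cl L X → cl L Y ⊆ cl L X
  cl-idem X⊆E = cl-least (cl-isFlat X⊆E)

  loop∈cl : ∀ {X x} → IsLoop L x → X ⊆ E L → x ∈ cl L X
  loop∈cl {X} {x} (x∈E , r≡0) X⊆E = r-∪⁅⁆≤⇒∈cl X⊆E x∈E (begin
    r L (X ∪ ⁅ x ⁆)   ≤⟨ r-subadditive X⊆E (x∈p⇒⁅x⁆⊆p x∈E) ⟩
    r L X + r L ⁅ x ⁆ ≡⟨ cong (r L X +_) r≡0 ⟩
    r L X + 0         ≡⟨ +-identityʳ _ ⟩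
    r L X             ∎)

  r-split : ∀ {Y} C → Y ⊆ E L → r L Y ≤ r L (Y ∩ C) + ∣ Y ─ C ∣
  r-split {Y} C Y⊆E = begin
    r L Y                     ≤⟨ r-monotone (∪-least Y∩C⊆E Y─C⊆E) Y⊆ ⟩
    r L ((Y ∩ C) ∪ (Y ─ C))   ≤⟨ r-subadditive Y∩C⊆E Y─C⊆E ⟩
    r L (Y ∩ C) + r L (Y ─ C) ≤⟨ +-monoʳ-≤ (r L (Y ∩ C)) (r-bound L _ Y─C⊆E) ⟩
    r L (Y ∩ C) + ∣ Y ─ C ∣   ∎
    where
    Y∩C⊆E : Y ∩ C ⊆ E L
    Y∩C⊆E y∈ = Y⊆E (p∩q⊆p _ _ y∈)
    Y─C⊆E : Y ─ C ⊆ E L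
    Y─C⊆E y∈ = Y⊆E (p─q⊆p _ _ y∈)
    Y⊆ : Y ⊆ (Y ∩ C) ∪ (Y ─ C)
    Y⊆ {y} y∈Y with y ∈? C
    ... | yes y∈C = p⊆p∪q _ (x∈p∩q⁺ (y∈Y , y∈C))
    ... | no y∉C  = q⊆p∪q _ _ (x∈p∧x∉q⇒x∈p─q y∈Y y∉C)

IndependentOver : Matroid n → Subset n → Subset n → Set
IndependentOver L T Y = ∀ {y} → y ∈ Y → y ∉ cl L ((Y - y) ∪ T)

module _ (L : Matroid n) {T} (T⊆E : T ⊆ E L) where
  open Closure L
  open ≤-Reasoning

  independentOver⇒skew : ∀ Y → Y ⊆ E L → IndependentOver L T Y → r L Y + r L T ≤ r L (Y ∪ T)
  independentOver⇒skew = deletion-induction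
    (λ Y → Y ⊆ E L → IndependentOver L T Y → r L Y + r L T ≤ r L (Y ∪ T)) step
    where
    step : ∀ Y → (∀ {y} → y ∈ Y → Y - y ⊆ E L → IndependentOver L T (Y - y) →
                          r L (Y - y) + r L T ≤ r L ((Y - y) ∪ T)) →
           Y ⊆ E L → IndependentOver L T Y → r L Y + r L T ≤ r L (Y ∪ T)
    step Y ih Y⊆E indep with nonempty? Y
    ... | no Y-empty = begin
      r L Y + r L T ≡⟨ cong (_+ r L T) rY≡0 ⟩
      r L T         ≤⟨ r-monotone (∪-least Y⊆E T⊆E) (q⊆p∪q Y T) ⟩
      r L (Y ∪ T)   ∎
      where
      ∣Y∣≡0 = trans (cong ∣_∣ (Empty-unique Y-empty)) (∣⊥∣≡0 n)
      rY≡0 = n≤0⇒n≡0 (≤-trans (r-bound L Y Y⊆E) (≤-reflexive ∣Y∣≡0))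
    ... | yes (y , y∈Y) = begin
      r L Y + r L T          ≤⟨ +-monoˡ-≤ (r L T) (≤-trans (r-monotone (∪⁅⁆-least Y'⊆E y∈E) Y⊆Y'∪y)
                                                         (r-∪⁅⁆≤suc Y'⊆E y∈E)) ⟩
      suc (r L Y' + r L T)   ≤⟨ s≤s (ih y∈Y Y'⊆E indep') ⟩
      suc (r L (Y' ∪ T))     ≤⟨ ∉cl⇒r< (∪-least Y'⊆E T⊆E) y∈E (indep y∈Y) ⟩
      r L ((Y' ∪ T) ∪ ⁅ y ⁆) ≤⟨ r-monotone (∪-least Y⊆E T⊆E) Y'Ty⊆YT ⟩
      r L (Y ∪ T)            ∎
      where
      Y' = Y - y
      y∈E = Y⊆E y∈Y
      Y'⊆E : Y' ⊆ E L
      Y'⊆E t∈ = Y⊆E (p─q⊆p _ _ t∈)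
      Y'Ty⊆YT : (Y' ∪ T) ∪ ⁅ y ⁆ ⊆ Y ∪ T
      Y'Ty⊆YT = ∪⁅⁆-least (∪-least (λ t∈ → p⊆p∪q T (p─q⊆p _ _ t∈)) (q⊆p∪q Y T))
                          (p⊆p∪q T y∈Y)
      Y⊆Y'∪y : Y ⊆ Y' ∪ ⁅ y ⁆
      Y⊆Y'∪y {t} t∈Y with t ≟ᶠ y
      ... | yes refl = q⊆p∪q Y' _ (x∈⁅x⁆ y)
      ... | no t≢y   = p⊆p∪q _ (x∈p∧x≢y⇒x∈p-y t∈Y t≢y)
      indep' : IndependentOver L T Y'
      indep' {t} t∈Y' t∈cl =
        indep (p─q⊆p _ _ t∈Y')
              (cl-mono Y'-t∪T⊆ (∪-least (λ u∈ → Y⊆E (p─q⊆p _ _ u∈)) T⊆E) t∈cl)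
        where
        Y'-t∪T⊆ : (Y' - t) ∪ T ⊆ (Y - t) ∪ T
        Y'-t∪T⊆ = ∪-least (λ u∈ → p⊆p∪q T (x∈p∧x≢y⇒x∈p-y (p─q⊆p _ _ (p─q⊆p _ _ u∈))
                                                         (x∉⁅y⁆⇒x≢y (proj₂ (x∈p─q⁻ _ _ u∈)))))
                          (q⊆p∪q _ T)

  independentOver-spanning : ∀ Y → Y ⊆ E L →
    ∃ λ Y' → Y' ⊆ Y × IndependentOver L T Y' × Y ⊆ cl L (Y' ∪ T)
  independentOver-spanning = deletion-induction
    (λ Y → Y ⊆ E L → ∃ λ Y' → Y' ⊆ Y × IndependentOver L T Y' × Y ⊆ cl L (Y' ∪ T)) step
    where
    step : ∀ Y → (∀ {y} → y ∈ Y → Y - y ⊆ E L →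
                    ∃ λ Y' → Y' ⊆ Y - y × IndependentOver L T Y' × Y - y ⊆ cl L (Y' ∪ T)) →
           Y ⊆ E L → ∃ λ Y' → Y' ⊆ Y × IndependentOver L T Y' × Y ⊆ cl L (Y' ∪ T)
    step Y ih Y⊆E with any? (λ y → (y ∈? Y) ×-dec (y ∈? cl L ((Y - y) ∪ T)))
    ... | no none = Y , (λ y∈ → y∈) , (λ y∈Y y∈cl → none (_ , y∈Y , y∈cl)) ,
                    (λ y∈Y → X⊆cl (∪-least Y⊆E T⊆E) (p⊆p∪q T y∈Y))
    ... | yes (y , y∈Y , y∈cl) with ih y∈Y (λ t∈ → Y⊆E (p─q⊆p _ _ t∈))
    ...   | Y' , Y'⊆ , indep , Y-y⊆cl = Y' , (λ t∈ → p─q⊆p _ _ (Y'⊆ t∈)) , indep , Y⊆cl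
      where
      Y'T⊆E : Y' ∪ T ⊆ E L
      Y'T⊆E = ∪-least (λ t∈ → Y⊆E (p─q⊆p _ _ (Y'⊆ t∈))) T⊆E
      Y⊆cl : Y ⊆ cl L (Y' ∪ T)
      Y⊆cl {t} t∈Y with t ≟ᶠ y
      ... | yes refl = cl-idem Y'T⊆E (∪-least Y-y⊆cl (λ u∈ → X⊆cl Y'T⊆E (q⊆p∪q Y' T u∈))) y∈cl
      ... | no t≢y   = Y-y⊆cl (x∈p∧x≢y⇒x∈p-y t∈Y t≢y)

module _ (L : Matroid n) {Q Y d} (Q-modular : IsModularFlat L Q) (Y⊆E : Y ⊆ E L) (d∈E : d ∈ E L) where
  open Closure L
  open ≤-Reasoning

  private
    F = cl L (Y ∪ ⁅ d ⁆)
    Q⊆E : Q ⊆ E L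
    Q⊆E = proj₁ (proj₁ Q-modular)
    Yd⊆E : Y ∪ ⁅ d ⁆ ⊆ E L
    Yd⊆E = ∪⁅⁆-least Y⊆E d∈E
    modular : r L Q + r L F ≡ r L (Q ∪ F) + r L (Q ∩ F)
    modular = proj₂ Q-modular F (cl-isFlat Yd⊆E)

  modular-trace-rank≤1 : r L Y + r L Q ≤ r L (Y ∪ Q) → r L (Q ∩ cl L (Y ∪ ⁅ d ⁆)) ≤ 1
  modular-trace-rank≤1 Y-skew-Q = +-cancelˡ-≤ (r L Y + r L Q) _ _ (begin
    r L Y + r L Q + r L (Q ∩ F) ≤⟨ +-monoˡ-≤ (r L (Q ∩ F))
                                     (≤-trans Y-skew-Q (r-monotone (∪-least Q⊆E cl⊆E) Y∪Q⊆)) ⟩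
    r L (Q ∪ F) + r L (Q ∩ F)   ≡⟨ sym modular ⟩
    r L Q + r L F               ≤⟨ +-monoʳ-≤ (r L Q)
                                     (≤-trans (r-cl Yd⊆E) (r-∪⁅⁆≤suc Y⊆E d∈E)) ⟩
    r L Q + suc (r L Y)         ≡⟨ +-suc (r L Q) (r L Y) ⟩
    suc (r L Q + r L Y)         ≡⟨ cong suc (+-comm (r L Q) (r L Y)) ⟩
    suc (r L Y + r L Q)         ≡⟨ +-comm 1 _ ⟩
    r L Y + r L Q + 1           ∎)
    where
    Y∪Q⊆ : Y ∪ Q ⊆ Q ∪ F
    Y∪Q⊆ = ∪-least (λ y∈ → q⊆p∪q Q F (X⊆cl Yd⊆E (p⊆p∪q _ y∈))) (p⊆p∪q F)

  modular-trace-spans : d ∈ cl L (Y ∪ Q) → d ∈ cl L (Y ∪ (Q ∩ cl L (Y ∪ ⁅ d ⁆)))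
  modular-trace-spans d∈cl = r-∪⁅⁆≤⇒∈cl W⊆E d∈E (≤-trans (r-monotone cl⊆E Wd⊆F) rF≤rW)
    where
    W = Y ∪ (Q ∩ F)
    W⊆E : W ⊆ E L
    W⊆E = ∪-least Y⊆E (λ x∈ → Q⊆E (p∩q⊆p _ _ x∈))
    YQ⊆E : Y ∪ Q ⊆ E L
    YQ⊆E = ∪-least Y⊆E Q⊆E
    Wd⊆F : W ∪ ⁅ d ⁆ ⊆ F
    Wd⊆F = ∪⁅⁆-least (∪-least (λ y∈ → X⊆cl Yd⊆E (p⊆p∪q _ y∈)) (p∩q⊆q _ _))
                     (X⊆cl Yd⊆E (q⊆p∪q Y _ (x∈⁅x⁆ d)))
    Q∪F⊆ : Q ∪ F ⊆ cl L (Y ∪ Q)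
    Q∪F⊆ = ∪-least (λ q∈ → X⊆cl YQ⊆E (q⊆p∪q Y Q q∈))
                   (cl-idem YQ⊆E (∪⁅⁆-least (λ y∈ → X⊆cl YQ⊆E (p⊆p∪q Q y∈)) d∈cl))
    rF≤rW : r L F ≤ r L W
    rF≤rW = +-cancelˡ-≤ (r L Q) _ _ (begin
      r L Q + r L F              ≡⟨ modular ⟩
      r L (Q ∪ F) + r L (Q ∩ F)  ≤⟨ +-monoˡ-≤ (r L (Q ∩ F))
                                      (≤-trans (r-monotone cl⊆E Q∪F⊆) (r-cl YQ⊆E)) ⟩
      r L (Y ∪ Q) + r L (Q ∩ F)  ≤⟨ +-mono-≤ (r-monotone (∪-least W⊆E Q⊆E) Y∪Q⊆W∪Q)
                                             (r-monotone (λ x∈ → W⊆E (p∩q⊆p _ _ x∈)) Q∩F⊆W∩Q) ⟩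
      r L (W ∪ Q) + r L (W ∩ Q)  ≤⟨ r-submod L W Q W⊆E Q⊆E ⟩
      r L W + r L Q              ≡⟨ +-comm (r L W) (r L Q) ⟩
      r L Q + r L W              ∎)
      where
      Y∪Q⊆W∪Q : Y ∪ Q ⊆ W ∪ Q
      Y∪Q⊆W∪Q = ∪-least (λ y∈ → p⊆p∪q Q (p⊆p∪q _ y∈)) (q⊆p∪q W Q)
      Q∩F⊆W∩Q : Q ∩ F ⊆ W ∩ Q
      Q∩F⊆W∩Q x∈ = x∈p∩q⁺ (q⊆p∪q Y _ x∈ , p∩q⊆p _ _ x∈)

module _ (L : Matroid n) {Q d} (Q-modular : IsModularFlat L Q) (d∈E : d ∈ E L) (d∉Q : d ∉ Q) where
  open Closure L

  private
    Q⊆E : Q ⊆ E L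
    Q⊆E = proj₁ (proj₁ Q-modular)

  modularFlat⇒thin-span : d ∈ cl L (E L - d) →
    ∃ λ W → W ⊆ E L × d ∉ W × d ∈ cl L W × r L (Q ∩ cl L (W ∪ ⁅ d ⁆)) ≤ 1
  modularFlat⇒thin-span d∈cl with independentOver-spanning L Q⊆E (E L - d) (p─q⊆p _ _)
  ... | Y , Y⊆ , indep , E-d⊆cl =
    W , W⊆E , d∉W , modular-trace-spans L Q-modular Y⊆E d∈E d∈cl[Y∪Q] ,
    ≤-trans (r-monotone (λ x∈ → Q⊆E (p∩q⊆p _ _ x∈)) Q∩cl⊆Q∩F)
            (modular-trace-rank≤1 L Q-modular Y⊆E d∈E (independentOver⇒skew L Q⊆E Y Y⊆E indep))
    where
    F = cl L (Y ∪ ⁅ d ⁆)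
    W = Y ∪ (Q ∩ F)
    Y⊆E : Y ⊆ E L
    Y⊆E y∈ = p─q⊆p _ _ (Y⊆ y∈)
    Yd⊆E : Y ∪ ⁅ d ⁆ ⊆ E L
    Yd⊆E = ∪⁅⁆-least Y⊆E d∈E
    W⊆E : W ⊆ E L
    W⊆E = ∪-least Y⊆E (λ x∈ → Q⊆E (p∩q⊆p _ _ x∈))
    d∉W : d ∉ W
    d∉W d∈ = [ (λ d∈Y → x∉p-x (Y⊆ d∈Y)) , (λ d∈Q∩F → d∉Q (p∩q⊆p _ _ d∈Q∩F)) ]′
               (x∈p∪q⁻ _ _ d∈)
    d∈cl[Y∪Q] : d ∈ cl L (Y ∪ Q)
    d∈cl[Y∪Q] = cl-idem (∪-least Y⊆E Q⊆E) E-d⊆cl d∈cl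
    Wd⊆F : W ∪ ⁅ d ⁆ ⊆ F
    Wd⊆F = ∪⁅⁆-least (∪-least (λ y∈ → X⊆cl Yd⊆E (p⊆p∪q _ y∈)) (p∩q⊆q _ _))
                     (X⊆cl Yd⊆E (q⊆p∪q Y _ (x∈⁅x⁆ d)))
    Q∩cl⊆Q∩F : Q ∩ cl L (W ∪ ⁅ d ⁆) ⊆ Q ∩ F
    Q∩cl⊆Q∩F x∈ = x∈p∩q⁺ (p∩q⊆p _ _ x∈ , cl-least (cl-isFlat Yd⊆E) Wd⊆F (p∩q⊆q _ _ x∈))

SpanForces : Matroid n → Fin n → Fin n → Set
SpanForces L d c = ∀ W → W ⊆ E L → d ∉ W → d ∈ cl L W → c ∈ cl L (W ∪ ⁅ d ⁆)

module _ (L : Matroid n) where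
  open Closure L
  open ≤-Reasoning

  -- For a cover C ∪ D = E the contraction term collapses because E − D = C − D.
  spliceRank≡ : ∀ {C D X} → C ∪ D ≡ E L → X ⊆ E L →
    spliceRank (restrictRank L C) C (contractRank L (E L ─ D)) D X ≡
    (r L (X ∩ C) + ∣ X ─ C ∣) ⊓ r L (X ∪ (E L ─ D))
  spliceRank≡ {C} {D} {X} C∪D≡E X⊆E = cong ((r L (X ∩ C) + ∣ X ─ C ∣) ⊓_) (begin-equality
    r L U ∸ r L K + r L (C ─ D) ≡⟨ cong (λ S → r L U ∸ r L K + r L S) C─D≡K ⟩
    r L U ∸ r L K + r L K       ≡⟨ m∸n+n≡m (r-monotone U⊆E (q⊆p∪q _ K)) ⟩
    r L U                       ≡⟨ cong (r L) U≡X∪K ⟩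
    r L (X ∪ K)                 ∎)
    where
    K = E L ─ D
    U = (X ∩ D) ∪ K
    U⊆E : U ⊆ E L
    U⊆E = ∪-least (λ x∈ → X⊆E (p∩q⊆p _ _ x∈)) (p─q⊆p _ _)
    C─D≡K : C ─ D ≡ K
    C─D≡K = ⊆-antisym
      (λ x∈ → let x∈C , x∉D = x∈p─q⁻ C D x∈ in
              x∈p∧x∉q⇒x∈p─q (subst (_ ∈_) C∪D≡E (p⊆p∪q D x∈C)) x∉D)
      (λ x∈ → let x∈E , x∉D = x∈p─q⁻ (E L) D x∈ in
              x∈p∧x∉q⇒x∈p─q (x∈p∪q∧x∉q⇒x∈p (subst (_ ∈_) (sym C∪D≡E) x∈E) x∉D) x∉D)
    U≡X∪K : U ≡ X ∪ K
    U≡X∪K = ⊆-antisym (∪-least (λ x∈ → p⊆p∪q K (p∩q⊆p _ _ x∈)) (q⊆p∪q X K)) X∪K⊆U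
      where
      X∪K⊆U : X ∪ K ⊆ U
      X∪K⊆U {x} x∈ with x∈p∪q⁻ X K x∈ | x ∈? D
      ... | inj₁ x∈X | yes x∈D = p⊆p∪q K (x∈p∩q⁺ (x∈X , x∈D))
      ... | inj₁ x∈X | no x∉D  = q⊆p∪q _ K (x∈p∧x∉q⇒x∈p─q (X⊆E x∈X) x∉D)
      ... | inj₂ x∈K | _       = q⊆p∪q _ K x∈K

  freeSeparator⇒spanForces : ∀ {C D c d} → IsFreeSeparator L C D → c ∈ C ─ D → d ∈ D ─ C →
                             SpanForces L d c
  freeSeparator⇒spanForces {C} {D} {c} {d} (C∪D≡E , r≡splice) c∈C─D d∈D─C W W⊆E d∉W d∈cl =
    r-∪⁅⁆≤⇒∈cl X⊆E c∈E (begin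
      r L (X ∪ ⁅ c ⁆) ≤⟨ r-monotone (∪-least X⊆E (p─q⊆p _ _))
                                    (∪⁅⁆-least (p⊆p∪q K) (q⊆p∪q X K c∈K)) ⟩
      r L (X ∪ K)     ≡⟨ sym r≡r[X∪K] ⟩
      r L X           ∎)
    where
    K = E L ─ D
    X = W ∪ ⁅ d ⁆
    c∈E = subst (_ ∈_) C∪D≡E (p⊆p∪q D (p─q⊆p C D c∈C─D))
    d∈E = subst (_ ∈_) C∪D≡E (q⊆p∪q C D (p─q⊆p D C d∈D─C))
    c∈K : c ∈ K
    c∈K = x∈p∧x∉q⇒x∈p─q c∈E (proj₂ (x∈p─q⁻ C D c∈C─D))
    X⊆E : X ⊆ E L
    X⊆E = ∪⁅⁆-least W⊆E d∈E
    W─C⊂X─C : W ─ C ⊂ X ─ C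
    W─C⊂X─C = (λ x∈ → let x∈W , x∉C = x∈p─q⁻ W C x∈ in
                       x∈p∧x∉q⇒x∈p─q (p⊆p∪q _ x∈W) x∉C) ,
              d , x∈p∧x∉q⇒x∈p─q (q⊆p∪q W _ (x∈⁅x⁆ d)) (proj₂ (x∈p─q⁻ D C d∈D─C)) ,
              (λ d∈ → d∉W (p─q⊆p W C d∈))
    r<first : r L X < r L (X ∩ C) + ∣ X ─ C ∣
    r<first = begin-strict
      r L X                   ≡⟨ proj₂ (x∈cl⁻ d∈cl) ⟩
      r L W                   ≤⟨ r-split C W⊆E ⟩
      r L (W ∩ C) + ∣ W ─ C ∣ <⟨ +-mono-≤-< (r-monotone (λ x∈ → X⊆E (p∩q⊆p _ _ x∈)) W∩C⊆X∩C)
                                             (p⊂q⇒∣p∣<∣q∣ W─C⊂X─C) ⟩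
      r L (X ∩ C) + ∣ X ─ C ∣ ∎
      where
      W∩C⊆X∩C : W ∩ C ⊆ X ∩ C
      W∩C⊆X∩C x∈ = x∈p∩q⁺ (p⊆p∪q _ (p∩q⊆p _ _ x∈) , p∩q⊆q _ _ x∈)
    r≡⊓ : r L X ≡ (r L (X ∩ C) + ∣ X ─ C ∣) ⊓ r L (X ∪ K)
    r≡⊓ = trans (r≡splice X X⊆E) (spliceRank≡ C∪D≡E X⊆E)
    r≡r[X∪K] : r L X ≡ r L (X ∪ K)
    r≡r[X∪K] with ⊓-sel (r L (X ∩ C) + ∣ X ─ C ∣) (r L (X ∪ K))
    ... | inj₁ ⊓≡first  = ⊥-elim (<⇒≢ r<first (trans r≡⊓ ⊓≡first))
    ... | inj₂ ⊓≡second = trans r≡⊓ ⊓≡second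

  spanForces⇒freeSeparator : ∀ {c d} → c ∈ E L → d ∈ E L → c ≢ d → SpanForces L d c →
                             IsFreeSeparator L (E L - d) (E L - c)
  spanForces⇒freeSeparator {c} {d} c∈E d∈E c≢d d⇒c = C∪D≡E , λ X X⊆E →
    trans (≡-⊓ (r-split C X⊆E) (r-monotone (∪-least X⊆E (p─q⊆p _ _)) (p⊆p∪q K)) (attained X⊆E))
          (sym (spliceRank≡ C∪D≡E X⊆E))
    where
    C = E L - d
    D = E L - c
    K = E L ─ D
    C∪D≡E : C ∪ D ≡ E L
    C∪D≡E = ⊆-antisym (∪-least (p─q⊆p _ _) (p─q⊆p _ _)) E⊆C∪D
      where
      E⊆C∪D : E L ⊆ C ∪ D
      E⊆C∪D {x} x∈E with x ≟ᶠ d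
      ... | yes refl = q⊆p∪q C D (x∈p∧x≢y⇒x∈p-y x∈E (λ d≡c → c≢d (sym d≡c)))
      ... | no x≢d   = p⊆p∪q D (x∈p∧x≢y⇒x∈p-y x∈E x≢d)
    attained : ∀ {X} → X ⊆ E L → r L (X ∩ C) + ∣ X ─ C ∣ ≤ r L X ⊎ r L (X ∪ K) ≤ r L X
    attained {X} X⊆E with d ∈? X
    ... | no d∉X = inj₁ (begin
      r L (X ∩ C) + ∣ X ─ C ∣ ≡⟨ cong (r L (X ∩ C) +_) ∣X─C∣≡0 ⟩
      r L (X ∩ C) + 0         ≡⟨ +-identityʳ _ ⟩
      r L (X ∩ C)             ≤⟨ r-monotone X⊆E (p∩q⊆p X C) ⟩
      r L X                   ∎)
      where
      X─C⊆⊥ : X ─ C ⊆ ⊥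
      X─C⊆⊥ x∈ with x∈⁅y⁆⇒x≡y d (p⊆q⇒p─[q-y]⊆⁅y⁆ X⊆E x∈)
      ... | refl = ⊥-elim (d∉X (p─q⊆p X C x∈))
      ∣X─C∣≡0 : ∣ X ─ C ∣ ≡ 0
      ∣X─C∣≡0 = n≤0⇒n≡0 (≤-trans (p⊆q⇒∣p∣≤∣q∣ X─C⊆⊥) (≤-reflexive (∣⊥∣≡0 n)))
    ... | yes d∈X with d ∈? cl L (X - d)
    ...   | yes d∈cl = inj₂ (begin
      r L (X ∪ K)     ≤⟨ r-monotone (∪⁅⁆-least X⊆E c∈E) (∪-least (p⊆p∪q _) K⊆⁅c⁆) ⟩
      r L (X ∪ ⁅ c ⁆) ≡⟨ proj₂ (x∈cl⁻ c∈cl) ⟩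
      r L X           ∎)
      where
      K⊆⁅c⁆ : K ⊆ X ∪ ⁅ c ⁆
      K⊆⁅c⁆ x∈ = q⊆p∪q X _ (p⊆q⇒p─[q-y]⊆⁅y⁆ ⊆-refl x∈)
      c∈cl : c ∈ cl L X
      c∈cl = cl-mono (∪⁅⁆-least (p─q⊆p X _) d∈X) X⊆E
                     (d⇒c (X - d) (λ x∈ → X⊆E (p─q⊆p X _ x∈)) x∉p-x d∈cl)
    ...   | no d∉cl = inj₁ (begin
      r L (X ∩ C) + ∣ X ─ C ∣ ≤⟨ +-mono-≤ (r-monotone X-d⊆E X∩C⊆X-d) ∣X─C∣≤1 ⟩
      r L (X - d) + 1         ≡⟨ +-comm _ 1 ⟩
      suc (r L (X - d))       ≤⟨ ∉cl⇒r< X-d⊆E d∈E d∉cl ⟩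
      r L ((X - d) ∪ ⁅ d ⁆)   ≤⟨ r-monotone X⊆E (∪⁅⁆-least (p─q⊆p X _) d∈X) ⟩
      r L X                   ∎)
      where
      X-d⊆E : X - d ⊆ E L
      X-d⊆E x∈ = X⊆E (p─q⊆p X _ x∈)
      X∩C⊆X-d : X ∩ C ⊆ X - d
      X∩C⊆X-d x∈ = let x∈X , x∈C = x∈p∩q⁻ X C x∈ in
        x∈p∧x∉q⇒x∈p─q x∈X (proj₂ (x∈p─q⁻ (E L) _ x∈C))
      ∣X─C∣≤1 : ∣ X ─ C ∣ ≤ 1
      ∣X─C∣≤1 = ≤-trans (p⊆q⇒∣p∣≤∣q∣ (p⊆q⇒p─[q-y]⊆⁅y⁆ {p = X} {y = d} X⊆E))
                        (≤-reflexive (∣⁅x⁆∣≡1 d))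

  irreducible⇒¬spanForces : ∀ {c d} → Irreducible L → c ∈ E L → d ∈ E L → c ≢ d →
                            ¬ SpanForces L d c
  irreducible⇒¬spanForces {c} {d} irr c∈E d∈E c≢d d⇒c =
    irr _ _ (spanForces⇒freeSeparator c∈E d∈E c≢d d⇒c)
        ((c , x∈p∧x∉q⇒x∈p─q (x∈p∧x≢y⇒x∈p-y c∈E c≢d) x∉p-x) ,
         (d , x∈p∧x∉q⇒x∈p─q (x∈p∧x≢y⇒x∈p-y d∈E (λ d≡c → c≢d (sym d≡c))) x∉p-x))

module _ (L : Matroid n) (irr : Irreducible L) where
  open Closure L
  open ≤-Reasoning

  irreducible-cl⁅⁆ : ∀ {c t} → t ∈ E L → c ∈ cl L ⁅ t ⁆ → c ≡ t
  irreducible-cl⁅⁆ {c} {t} t∈E c∈cl with c ≟ᶠ t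
  ... | yes c≡t = c≡t
  ... | no c≢t  = ⊥-elim (irreducible⇒¬spanForces L irr (cl⊆E c∈cl) t∈E c≢t
                    λ W W⊆E _ _ → cl-mono (q⊆p∪q W _) (∪⁅⁆-least W⊆E t∈E) c∈cl)

  module _ (2≤∣E∣ : 2 ≤ ∣ E L ∣) where

    irreducible⇒¬loop : ∀ {c} → ¬ IsLoop L c
    irreducible⇒¬loop loop with 2≤∣p∣⇒∃≢ 2≤∣E∣ (proj₁ loop)
    ... | e , e∈E , e≢c = e≢c (sym (irreducible-cl⁅⁆ e∈E (loop∈cl loop (x∈p⇒⁅x⁆⊆p e∈E))))

    irreducible⇒¬coloop : ∀ {d} → d ∈ E L → d ∈ cl L (E L - d)
    irreducible⇒¬coloop {d} d∈E with d ∈? cl L (E L - d)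
    ... | yes d∈cl = d∈cl
    ... | no d∉cl with 2≤∣p∣⇒∃≢ 2≤∣E∣ d∈E
    ...   | e , e∈E , e≢d = ⊥-elim (irreducible⇒¬spanForces L irr e∈E d∈E e≢d
              λ W W⊆E d∉W d∈cl → ⊥-elim (d∉cl (cl-mono (W⊆E-d W⊆E d∉W) (p─q⊆p _ _) d∈cl)))
      where
      W⊆E-d : ∀ {W} → W ⊆ E L → d ∉ W → W ⊆ E L - d
      W⊆E-d W⊆E d∉W x∈W = x∈p∧x≢y⇒x∈p-y (W⊆E x∈W) λ { refl → d∉W x∈W }

    irreducible-rank≤1-closed : ∀ {S c} → S ⊆ E L → r L S ≤ 1 → c ∈ cl L S → c ∈ S
    irreducible-rank≤1-closed {S} {c} S⊆E rS≤1 c∈cl with c ∈? S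
    ... | yes c∈S = c∈S
    ... | no c∉S with any? (λ t → (t ∈? S) ×-dec ¬? (r L ⁅ t ⁆ ≟ 0))
    ...   | yes (t , t∈S , rt≢0) =
      ⊥-elim (c∉S (subst (_∈ S) (sym (irreducible-cl⁅⁆ (S⊆E t∈S) c∈cl⁅t⁆)) t∈S))
      where
      c∈cl⁅t⁆ : c ∈ cl L ⁅ t ⁆
      c∈cl⁅t⁆ = r-∪⁅⁆≤⇒∈cl (x∈p⇒⁅x⁆⊆p (S⊆E t∈S)) (cl⊆E c∈cl) (begin
        r L (⁅ t ⁆ ∪ ⁅ c ⁆) ≤⟨ r-monotone (∪⁅⁆-least S⊆E (cl⊆E c∈cl))
                                (∪⁅⁆-least (x∈p⇒⁅x⁆⊆p (p⊆p∪q _ t∈S)) (q⊆p∪q S _ (x∈⁅x⁆ c))) ⟩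
        r L (S ∪ ⁅ c ⁆)     ≡⟨ proj₂ (x∈cl⁻ c∈cl) ⟩
        r L S               ≤⟨ rS≤1 ⟩
        1                   ≤⟨ n≢0⇒n>0 rt≢0 ⟩
        r L ⁅ t ⁆           ∎)
    ...   | no none = ⊥-elim (irreducible⇒¬loop (cl⊆E c∈cl , n≤0⇒n≡0 (begin
        r L ⁅ c ⁆       ≤⟨ r-monotone (∪⁅⁆-least ⊥⊆E (cl⊆E c∈cl)) (q⊆p∪q ⊥ _) ⟩
        r L (⊥ ∪ ⁅ c ⁆) ≡⟨ proj₂ (x∈cl⁻ c∈cl⊥) ⟩
        r L ⊥           ≤⟨ r-bound L ⊥ ⊥⊆E ⟩
        ∣ ⊥ {n = n} ∣   ≡⟨ ∣⊥∣≡0 n ⟩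
        0               ∎)))
      where
      ⊥⊆E : ⊥ ⊆ E L
      ⊥⊆E x∈ = ⊥-elim (∉⊥ x∈)
      loops : ∀ {t} → t ∈ S → IsLoop L t
      loops {t} t∈S with r L ⁅ t ⁆ ≟ 0
      ... | yes rt≡0 = S⊆E t∈S , rt≡0
      ... | no rt≢0  = ⊥-elim (none (t , t∈S , rt≢0))
      c∈cl⊥ : c ∈ cl L ⊥
      c∈cl⊥ = cl-idem ⊥⊆E (λ t∈S → loop∈cl (loops t∈S) ⊥⊆E) c∈cl

    irreducible⇒cl⊆ : ∀ {T} →
      (∀ x → x ∈ cl L T ─ T → IsLoop L x ⊎ ∃ λ y → y ∈ T × IsParallel L x y) → cl L T ⊆ T
    irreducible⇒cl⊆ {T} loose {x} x∈cl with x ∈? T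
    ... | yes x∈T = x∈T
    ... | no x∉T with loose x (x∈p∧x∉q⇒x∈p─q x∈cl x∉T)
    ...   | inj₁ loop = ⊥-elim (irreducible⇒¬loop loop)
    ...   | inj₂ (y , _ , x∈E , y∈E , x≢y , _ , r⁅y⁆≡1 , r⁅x,y⁆≡1) =
      ⊥-elim (x≢y (irreducible-cl⁅⁆ y∈E (x∈cl⁺ x∈E (begin-equality
        r L (⁅ y ⁆ ∪ ⁅ x ⁆) ≡⟨ cong (r L) (∪-comm ⁅ y ⁆ ⁅ x ⁆) ⟩
        r L (⁅ x ⁆ ∪ ⁅ y ⁆) ≡⟨ r⁅x,y⁆≡1 ⟩
        1                   ≡⟨ sym r⁅y⁆≡1 ⟩
        r L ⁅ y ⁆           ∎))))

agree-comm : ∀ {M N : Matroid n} → (∀ X → X ⊆ E M ∩ E N → r N X ≡ r M X) →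
             ∀ X → X ⊆ E N ∩ E M → r M X ≡ r N X
agree-comm {M = M} {N} agree X X⊆ =
  sym (agree X (λ x∈ → x∈p∩q⁺ (swap (x∈p∩q⁻ (E N) (E M) (X⊆ x∈)))))

isGenParallelConnection-comm : ∀ {M N P : Matroid n} →
  IsGenParallelConnection M N P → IsGenParallelConnection N M P
isGenParallelConnection-comm {M = M} {N} (EP≡ , flats) =
  trans EP≡ (∪-comm (E M) (E N)) , λ F F⊆ →
    let to , from = flats F (subst (F ⊆_) (∪-comm (E N) (E M)) F⊆)
    in (λ F-flat → swap (to F-flat)) , (λ flats-NM → from (swap flats-NM))

module ParallelConnection (M N P : Matroid n) (agree : ∀ X → X ⊆ E M ∩ E N → r N X ≡ r M X)
                          (gp : IsGenParallelConnection M N P) where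
  private
    module CM = Closure M
    module CN = Closure N
    module CP = Closure P

  ∈EP : x ∈ E M ∪ E N → x ∈ E P
  ∈EP = subst (_ ∈_) (sym (proj₁ gp))

  cl-M⊆cl-P : ∀ {X} → X ⊆ E M → cl M X ⊆ cl P X
  cl-M⊆cl-P {X} X⊆EM x∈ = p∩q⊆p _ _ (CM.cl-least clP∩EM-flat X⊆ x∈)
    where
    X⊆EP : X ⊆ E P
    X⊆EP x∈X = ∈EP (p⊆p∪q _ (X⊆EM x∈X))
    clP∩EM-flat : IsFlat M (cl P X ∩ E M)
    clP∩EM-flat = proj₁ (proj₁ (proj₂ gp (cl P X) (λ x∈ → subst (_ ∈_) (proj₁ gp) (CP.cl⊆E x∈)))
                               (CP.cl-isFlat X⊆EP))
    X⊆ : X ⊆ cl P X ∩ E M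
    X⊆ x∈X = x∈p∩q⁺ (CP.X⊆cl X⊆EP x∈X , X⊆EM x∈X)

  cl-N-trace⊆cl-M : ∀ {X} → X ⊆ E M → cl N (cl M X ∩ E N) ∩ E M ⊆ cl M X
  cl-N-trace⊆cl-M {X} X⊆EM {x} x∈ =
    CM.cl-least (CM.cl-isFlat X⊆EM) (p∩q⊆p _ _) (CM.x∈cl⁺ x∈EM (begin-equality
    r M (Z ∪ ⁅ x ⁆) ≡⟨ sym (agree _ (∪⁅⁆-least Z⊆T (x∈p∩q⁺ (x∈EM , CN.cl⊆E x∈clN)))) ⟩
    r N (Z ∪ ⁅ x ⁆) ≡⟨ proj₂ (CN.x∈cl⁻ x∈clN) ⟩
    r N Z           ≡⟨ agree Z Z⊆T ⟩
    r M Z           ∎))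
    where
    open ≤-Reasoning
    Z = cl M X ∩ E N
    x∈clN = p∩q⊆p _ _ x∈
    x∈EM = p∩q⊆q _ _ x∈
    Z⊆T : Z ⊆ E M ∩ E N
    Z⊆T z∈ = x∈p∩q⁺ (CM.cl⊆E (p∩q⊆p _ _ z∈) , p∩q⊆q _ _ z∈)

  cl-P⊆ : ∀ {X} → X ⊆ E M → cl P X ⊆ cl M X ∪ cl N (cl M X ∩ E N)
  cl-P⊆ {X} X⊆EM = CP.cl-least G-flat (λ x∈X → p⊆p∪q _ (CM.X⊆cl X⊆EM x∈X))
    where
    Z = cl M X ∩ E N
    Z⊆EN : Z ⊆ E N
    Z⊆EN = p∩q⊆q _ _
    G = cl M X ∪ cl N Z
    G∩EM≡ : G ∩ E M ≡ cl M X
    G∩EM≡ = ⊆-antisym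
      (λ x∈ → let x∈G , x∈EM = x∈p∩q⁻ G _ x∈ in
              [ (λ x∈clM → x∈clM)
              , (λ x∈clN → cl-N-trace⊆cl-M X⊆EM (x∈p∩q⁺ (x∈clN , x∈EM))) ]′
                (x∈p∪q⁻ _ _ x∈G))
      (λ x∈ → x∈p∩q⁺ (p⊆p∪q _ x∈ , CM.cl⊆E x∈))
    G∩EN≡ : G ∩ E N ≡ cl N Z
    G∩EN≡ = ⊆-antisym
      (λ x∈ → let x∈G , x∈EN = x∈p∩q⁻ G _ x∈ in
              [ (λ x∈clM → CN.X⊆cl Z⊆EN (x∈p∩q⁺ (x∈clM , x∈EN))) , (λ x∈clN → x∈clN) ]′
                (x∈p∪q⁻ _ _ x∈G))
      (λ x∈ → x∈p∩q⁺ (q⊆p∪q _ _ x∈ , CN.cl⊆E x∈))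
    G-flat : IsFlat P G
    G-flat = proj₂ (proj₂ gp G (∪-least (λ x∈ → p⊆p∪q _ (CM.cl⊆E x∈))
                                        (λ x∈ → q⊆p∪q _ _ (CN.cl⊆E x∈))))
      ( subst (IsFlat M) (sym G∩EM≡) (CM.cl-isFlat X⊆EM)
      , subst (IsFlat N) (sym G∩EN≡) (CN.cl-isFlat Z⊆EN))

  cl-P∩E-M⊆cl-M : ∀ {X} → X ⊆ E M → cl P X ∩ E M ⊆ cl M X
  cl-P∩E-M⊆cl-M X⊆EM x∈ =
    [ (λ x∈clM → x∈clM)
    , (λ x∈clN → cl-N-trace⊆cl-M X⊆EM (x∈p∩q⁺ (x∈clN , p∩q⊆q _ _ x∈))) ]′
      (x∈p∪q⁻ _ _ (cl-P⊆ X⊆EM (p∩q⊆p _ _ x∈)))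

  spanForces-restrict : ∀ {c d} → SpanForces P d c → c ∈ E M → d ∈ E M → SpanForces M d c
  spanForces-restrict d⇒c c∈EM d∈EM W W⊆EM d∉W d∈cl =
    cl-P∩E-M⊆cl-M (∪⁅⁆-least W⊆EM d∈EM)
      (x∈p∩q⁺ (d⇒c W (λ x∈ → ∈EP (p⊆p∪q _ (W⊆EM x∈))) d∉W (cl-M⊆cl-P W⊆EM d∈cl)
             , c∈EM))

module _ (M N P : Matroid n) (agree : ∀ X → X ⊆ E M ∩ E N → r N X ≡ r M X)
         (gp : IsGenParallelConnection M N P) where
  private
    module PM = ParallelConnection M N P agree gp
    module PN = ParallelConnection N M P (agree-comm {M = M} {N} agree)
                                         (isGenParallelConnection-comm {M = M} {N} {P} gp)
    module CM = Closure M
    module CN = Closure N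

  ¬spanForces-within-M : ∀ {c d} → Irreducible M → c ∈ E M → d ∈ E M → c ≢ d → ¬ SpanForces P d c
  ¬spanForces-within-M irrM c∈EM d∈EM c≢d d⇒c =
    irreducible⇒¬spanForces M irrM c∈EM d∈EM c≢d (PM.spanForces-restrict d⇒c c∈EM d∈EM)

  ¬spanForces-within-N : ∀ {c d} → Irreducible N → c ∈ E N → d ∈ E N → c ≢ d → ¬ SpanForces P d c
  ¬spanForces-within-N irrN c∈EN d∈EN c≢d d⇒c =
    irreducible⇒¬spanForces N irrN c∈EN d∈EN c≢d (PN.spanForces-restrict d⇒c c∈EN d∈EN)

  ¬spanForces-into-M─N : ∀ {c d} → Irreducible N → 2 ≤ ∣ E N ∣ →
                         cl M (E M ∩ E N) ⊆ E M ∩ E N →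
                         c ∈ E M → c ∉ E N → d ∈ E N → ¬ SpanForces P d c
  ¬spanForces-into-M─N {c} {d} irrN 2≤∣EN∣ cl-T⊆T c∈EM c∉EN d∈EN d⇒c =
    [ (λ c∈clN → c∉EN (CN.cl⊆E c∈clN)) ,
      (λ c∈clM → c∉EN (p∩q⊆q _ _ (cl-T⊆T (CM.cl-mono trace⊆T (p∩q⊆p _ _) c∈clM)))) ]′
      (x∈p∪q⁻ _ _ (PN.cl-P⊆ (∪⁅⁆-least (p─q⊆p _ _) d∈EN) c∈clP))
    where
    W = E N - d
    c∈clP : c ∈ cl P (W ∪ ⁅ d ⁆)
    c∈clP = d⇒c W (λ x∈ → PN.∈EP (p⊆p∪q _ (p─q⊆p _ _ x∈))) x∉p-x
                  (PN.cl-M⊆cl-P (p─q⊆p _ _) (irreducible⇒¬coloop N irrN 2≤∣EN∣ d∈EN))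
    trace⊆T : cl N (W ∪ ⁅ d ⁆) ∩ E M ⊆ E M ∩ E N
    trace⊆T x∈ = x∈p∩q⁺ (p∩q⊆q _ _ x∈ , CN.cl⊆E (p∩q⊆p _ _ x∈))

  ¬spanForces-into-N─M : ∀ {c d} → IsModularFlat M (cl M (E M ∩ E N)) →
                         cl M (E M ∩ E N) ⊆ E M ∩ E N →
                         Irreducible M → 2 ≤ ∣ E M ∣ → Irreducible N → 2 ≤ ∣ E N ∣ →
                         c ∉ E M → d ∈ E M → d ∉ E N → ¬ SpanForces P d c
  ¬spanForces-into-N─M {c} {d} Q-modular cl-T⊆T irrM 2≤∣EM∣ irrN 2≤∣EN∣ c∉EM d∈EM d∉EN d⇒c =
    refute (modularFlat⇒thin-span M Q-modular d∈EM (λ d∈Q → d∉EN (p∩q⊆q _ _ (cl-T⊆T d∈Q)))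
                                  (irreducible⇒¬coloop M irrM 2≤∣EM∣ d∈EM))
    where
    refute : ¬ ∃ λ W → W ⊆ E M × d ∉ W × d ∈ cl M W ×
                       r M (cl M (E M ∩ E N) ∩ cl M (W ∪ ⁅ d ⁆)) ≤ 1
    refute (W , W⊆EM , d∉W , d∈clW , thin) =
      [ (λ c∈clM → c∉EM (CM.cl⊆E c∈clM)) ,
        (λ c∈clN → c∉EM (p∩q⊆p _ _ (S⊆T
                     (irreducible-rank≤1-closed N irrN 2≤∣EN∣ (p∩q⊆q _ _) rS≤1 c∈clN)))) ]′
        (x∈p∪q⁻ _ _ (PM.cl-P⊆ (∪⁅⁆-least W⊆EM d∈EM) c∈clP))
      where
      c∈clP : c ∈ cl P (W ∪ ⁅ d ⁆)
      c∈clP = d⇒c W (λ x∈ → PM.∈EP (p⊆p∪q _ (W⊆EM x∈))) d∉W (PM.cl-M⊆cl-P W⊆EM d∈clW)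
      S = cl M (W ∪ ⁅ d ⁆) ∩ E N
      S⊆T : S ⊆ E M ∩ E N
      S⊆T x∈ = x∈p∩q⁺ (CM.cl⊆E (p∩q⊆p _ _ x∈) , p∩q⊆q _ _ x∈)
      S⊆Q∩ : S ⊆ cl M (E M ∩ E N) ∩ cl M (W ∪ ⁅ d ⁆)
      S⊆Q∩ x∈ = x∈p∩q⁺ (CM.X⊆cl (p∩q⊆p _ _) (S⊆T x∈) , p∩q⊆p _ _ x∈)
      rS≤1 : r N S ≤ 1
      rS≤1 = ≤-trans (≤-reflexive (agree S S⊆T))
                     (≤-trans (CM.r-monotone (λ x∈ → CM.cl⊆E (p∩q⊆p _ _ x∈)) S⊆Q∩) thin)

proposition5p3 : ∀ {n} (M N : Matroid n) →
    2 ≤ ∣ E M ∣ → 2 ≤ ∣ E N ∣ →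
    (∀ X → X ⊆ E M ∩ E N → r N X ≡ r M X) →
    IsModularFlat M (cl M (E M ∩ E N)) →
    (∀ x → x ∈ cl M (E M ∩ E N) ─ (E M ∩ E N) →
       IsLoop M x ⊎ ∃ (λ y → y ∈ E M ∩ E N × IsParallel M x y)) →
    Irreducible M → Irreducible N →
    (P : Matroid n) → IsGenParallelConnection M N P →
    Irreducible P
proposition5p3 M N 2≤∣EM∣ 2≤∣EN∣ agree Q-modular loose irrM irrN P gp
               C D sep ((c , c∈C─D) , (d , d∈D─C)) =
  ¬d⇒c (freeSeparator⇒spanForces P sep c∈C─D d∈D─C)
  where
  cl-T⊆T : cl M (E M ∩ E N) ⊆ E M ∩ E N
  cl-T⊆T = irreducible⇒cl⊆ M irrM 2≤∣EM∣ loose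
  c≢d : c ≢ d
  c≢d refl = proj₂ (x∈p─q⁻ D C d∈D─C) (p─q⊆p C D c∈C─D)
  c∈ : c ∈ E M ∪ E N
  c∈ = subst (_ ∈_) (trans (proj₁ sep) (proj₁ gp)) (p⊆p∪q D (p─q⊆p C D c∈C─D))
  d∈ : d ∈ E M ∪ E N
  d∈ = subst (_ ∈_) (trans (proj₁ sep) (proj₁ gp)) (q⊆p∪q C D (p─q⊆p D C d∈D─C))
  ¬d⇒c : ¬ SpanForces P d c
  ¬d⇒c with c ∈? E M | d ∈? E M
  ... | yes c∈EM | yes d∈EM = ¬spanForces-within-M M N P agree gp irrM c∈EM d∈EM c≢d
  ... | yes c∈EM | no d∉EM with c ∈? E N
  ...   | yes c∈EN = ¬spanForces-within-N M N P agree gp irrN c∈EN (x∈p∪q∧x∉p⇒x∈q d∈ d∉EM) c≢d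
  ...   | no c∉EN  = ¬spanForces-into-M─N M N P agree gp irrN 2≤∣EN∣ cl-T⊆T
                                          c∈EM c∉EN (x∈p∪q∧x∉p⇒x∈q d∈ d∉EM)
  ¬d⇒c | no c∉EM | _ with d ∈? E N
  ...   | yes d∈EN = ¬spanForces-within-N M N P agree gp irrN (x∈p∪q∧x∉p⇒x∈q c∈ c∉EM) d∈EN c≢d
  ...   | no d∉EN  = ¬spanForces-into-N─M M N P agree gp Q-modular cl-T⊆T irrM 2≤∣EM∣ irrN 2≤∣EN∣
                                          c∉EM (x∈p∪q∧x∉q⇒x∈p d∈ d∉EN) d∉EN
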